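{- Let $G=(V,E)$ be a connected strictly chordal graph, let $S$ be a minimal vertex separator of $G$, and let $v\in S$. Then $d(v)+1$ is a Laplacian eigenvalue of $G$ with multiplicity at least $|S|-1$.
   Context: All graphs are finite and simple; $d(v)$ is the degree of $v$. The Laplacian matrix of $G$ is $L(G)=D(G)-A(G)$, with $D(G)$ the diagonal degree matrix and $A(G)$ the adjacency matrix; its eigenvalues are the Laplacian eigenvalues of $G$. A block graph is a connected graph in which every block (maximal biconnected subgraph) is a clique. Two vertices $u,v$ are true twins if $N[u]=N[v]$, where $N[v]=N(v)\cup\{v\}$. A strictly chordal graph (block duplicate graph) is a graph obtained from a block graph by adding zero or more true twins to its vertices. For non-adjacent vertices $u,v$, a set $S\subset V$ is a $uv$-separator if $u$ and $v$ lie in different connected components of $G-S$; it is minimal if no proper subset is a $uv$-separator. A minimal vertex separator is a set that is a minimal $uv$-separator for some pair of non-adjacent vertices. -}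

module Defs where

open import Data.Nat using (ℕ; zero; suc; _∸_)
open import Data.Bool using (Bool; true; false; if_then_else_; _∧_; _∨_; not)
open import Data.Fin using (Fin; zero; suc; _≟_)
open import Data.Fin.Subset using (Subset; _∈_; _∉_; _⊂_; ∣_∣; ⊤; ∁)
open import Data.Product using (Σ; ∃; _×_; _,_)
open import Relation.Nullary using (¬_)
open import Relation.Nullary.Decidable using (⌊_⌋)
open import Relation.Binary.PropositionalEquality using (_≡_)
open import Data.Rational using (ℚ; 0ℚ; 1ℚ; _+_; _*_; -_)
import Data.Rational as ℚ

record Graph (n : ℕ) : Set where
  field
    adj    : Fin n → Fin n → Bool
    sym    : ∀ i j → adj i j ≡ adj j i
    irrefl : ∀ i → adj i i ≡ false
open Graph public

sumℕ : ∀ {n} → (Fin n → ℕ) → ℕ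
sumℕ {zero}  f = 0
sumℕ {suc n} f = f zero Data.Nat.+ sumℕ (λ i → f (suc i))

sumℚ : ∀ {n} → (Fin n → ℚ) → ℚ
sumℚ {zero}  f = 0ℚ
sumℚ {suc n} f = f zero + sumℚ (λ i → f (suc i))

degree : ∀ {n} → Graph n → Fin n → ℕ
degree G v = sumℕ (λ j → if adj G v j then 1 else 0)

data Reach {n} (G : Graph n) (B : Subset n) : Fin n → Fin n → Set where
  here : ∀ {u} → u ∈ B → Reach G B u u
  step : ∀ {u w v} → u ∈ B → adj G u w ≡ true → Reach G B w v → Reach G B u v

ConnectedOn : ∀ {n} → Graph n → Subset n → Set
ConnectedOn G B = ∀ u v → u ∈ B → v ∈ B → Reach G B u v

Connected : ∀ {n} → Graph n → Set
Connected G = ConnectedOn G ⊤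

_─_ : ∀ {n} → Subset n → Fin n → Subset n
(B ─ x) = Data.Vec.updateAt B x (λ _ → false)
  where import Data.Vec

Biconnected : ∀ {n} → Graph n → Subset n → Set
Biconnected G B = ConnectedOn G B × (∀ x → x ∈ B → ConnectedOn G (B ─ x))

IsBlock : ∀ {n} → Graph n → Subset n → Set
IsBlock G B = Biconnected G B × (∀ C → B ⊂ C → ¬ Biconnected G C)

IsClique : ∀ {n} → Graph n → Subset n → Set
IsClique G B = ∀ u v → u ∈ B → v ∈ B → ¬ (u ≡ v) → adj G u v ≡ true

IsBlockGraph : ∀ {n} → Graph n → Set
IsBlockGraph G = Connected G × (∀ B → IsBlock G B → IsClique G B)

-- Strictly chordal (block duplicate) graphs: obtained from a block
-- graph H by adding true twins, i.e. every vertex x of H is replaced by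
-- a nonempty clique f⁻¹(x) of pairwise true twins.

Surjective : ∀ {n m} → (Fin n → Fin m) → Set
Surjective {n} {m} f = ∀ (y : Fin m) → ∃ λ (x : Fin n) → f x ≡ y

IsStrictlyChordal : ∀ {n} → Graph n → Set
IsStrictlyChordal {n} G =
  Σ ℕ λ m → Σ (Graph m) λ H → Σ (Fin n → Fin m) λ f →
    IsBlockGraph H × Surjective f ×
    (∀ i j → adj G i j ≡ (not ⌊ i ≟ j ⌋ ∧ (⌊ f i ≟ f j ⌋ ∨ adj H (f i) (f j))))

IsSeparator : ∀ {n} → Graph n → Subset n → Fin n → Fin n → Set
IsSeparator G S u v = u ∉ S × v ∉ S × ¬ Reach G (∁ S) u v

IsMinimalSeparator : ∀ {n} → Graph n → Subset n → Fin n → Fin n → Set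
IsMinimalSeparator G S u v =
  IsSeparator G S u v × (∀ T → T ⊂ S → ¬ IsSeparator G T u v)

IsMinimalVertexSeparator : ∀ {n} → Graph n → Subset n → Set
IsMinimalVertexSeparator G S =
  ∃ λ u → ∃ λ v → ¬ (u ≡ v) × adj G u v ≡ false × IsMinimalSeparator G S u v

ℕtoℚ : ℕ → ℚ
ℕtoℚ k = ℚ.mkℚ+ k 1 (Data.Nat.Coprimality.sym (Data.Nat.Coprimality.1-coprimeTo k))
  where import Data.Nat.Coprimality

laplacian : ∀ {n} → Graph n → Fin n → Fin n → ℚ
laplacian G i j =
  if ⌊ i ≟ j ⌋ then ℕtoℚ (degree G i) else (if adj G i j then - 1ℚ else 0ℚ)

IsEigenvectorEq : ∀ {n} → Graph n → ℚ → (Fin n → ℚ) → Set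
IsEigenvectorEq G μ x = ∀ i → sumℚ (λ j → laplacian G i j * x j) ≡ μ * x i

LinearlyIndependent : ∀ {n k} → (Fin k → Fin n → ℚ) → Set
LinearlyIndependent {n} {k} xs =
  ∀ (c : Fin k → ℚ) → (∀ i → sumℚ (λ r → c r * xs r i) ≡ 0ℚ) → ∀ r → c r ≡ 0ℚ

-- μ is a Laplacian eigenvalue of G of multiplicity at least k:
-- the eigenspace of μ contains k linearly independent vectors
-- (for the symmetric matrix L, geometric = algebraic multiplicity).
EigenvalueMultAtLeast : ∀ {n} → Graph n → ℚ → ℕ → Set
EigenvalueMultAtLeast {n} G μ k =
  Σ (Fin k → Fin n → ℚ) λ xs → LinearlyIndependent xs × (∀ r → IsEigenvectorEq G μ (xs r))

-- Write G as the blow-up of a block graph H along f : V(G) → V(H): the fibres of f are cliques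
-- of true twins, and two fibres are completely joined exactly when their images are adjacent.
-- Let S be a minimal uv-separator. Every s ∈ S has a neighbour in the component of u and in the
-- component of v in G − S. If s, t ∈ S lay in different fibres, these neighbours would give two
-- internally disjoint paths from f s to f t in H, one through the image of each component. Their
-- union is a cycle, hence lies in a block of H, which is a clique; but no edge of H joins the
-- images of the two components. So S lies in one fibre: its vertices are pairwise true twins.
-- For true twins v, w the vector e_v − e_w is a Laplacian eigenvector for d(v) + 1, and the
-- vectors e_v − e_t, t ∈ S − v, are linearly independent.

module Submission where

open import Defs
open import Data.Nat using (ℕ; suc; _∸_)
open import Data.Fin using (Fin)
open import Data.Fin.Subset using (Subset; _∈_; ∣_∣)

import Data.Nat as ℕ
import Data.Nat.Properties as ℕ
open import Algebra.Properties.CommutativeSemigroup ℕ.+-commutativeSemigroup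
  using () renaming (interchange to +-interchange)
open import Data.Fin using (zero; suc; _≟_; punchIn)
open import Data.Fin.Subset using (_∉_; _⊆_; _⊂_; ∁)
import Data.Fin.Subset.Properties as Subset
import Data.Fin.Properties as Fin
open import Data.Bool using (Bool; true; false; not; _∧_; _∨_; if_then_else_; T)
open import Data.Product using (Σ; _×_; _,_; proj₁; proj₂)
open import Data.Sum using (_⊎_; inj₁; inj₂; [_,_]; map₁; swap) renaming (map to ⊎-map)
open import Data.Empty using (⊥; ⊥-elim)
open import Function using (_∘_; id)
open import Relation.Nullary using (¬_; Dec; yes; no)
open import Relation.Nullary.Decidable
  using (⌊_⌋; isYes≗does; ⌊⌋-map′; dec-true; dec-false; toWitness; decidable-stable)
open import Relation.Binary.PropositionalEquality
  using (_≡_; _≢_; refl; trans; cong; cong₂; subst; ≢-sym; module ≡-Reasoning) renaming (sym to ≡-sym)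
open import Data.List using (List; []; _∷_; _++_)
open import Data.List.Relation.Unary.Any using (here; there)
open import Data.List.Membership.Propositional using () renaming (_∈_ to _∈ᴸ_; _∉_ to _∉ᴸ_)
open import Data.List.Membership.Propositional.Properties using (∈-++⁺ˡ; ∈-++⁺ʳ; ∈-++⁻)
import Data.List.Membership.DecPropositional as DecMembership
open import Data.List.Relation.Binary.Subset.Propositional using () renaming (_⊆_ to _⊆ᴸ_)
open import Data.Rational using (ℚ; 0ℚ; 1ℚ; _+_; _*_; -_; _-_)
import Data.Rational.Properties as ℚ
import Data.Rational.Unnormalised as ℚᵘ
import Data.Rational.Unnormalised.Properties as ℚᵘ
open import Data.Rational.Solver using (module +-*-Solver)
open import Data.Integer using (1ℤ)
import Data.Integer as ℤ
import Data.Integer.Properties as ℤ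
open import Data.Integer.Tactic.RingSolver using (solve-∀)
import Data.Vec as Vec
import Data.Vec.Properties as Vec

⌊⌋-true : ∀ {P : Set} (p? : Dec P) → P → ⌊ p? ⌋ ≡ true
⌊⌋-true p? p = trans (isYes≗does p?) (dec-true p? p)

⌊⌋-false : ∀ {P : Set} (p? : Dec P) → ¬ P → ⌊ p? ⌋ ≡ false
⌊⌋-false p? ¬p = trans (isYes≗does p?) (dec-false p? ¬p)

∈-─⁺ : ∀ {m} {B : Subset m} {i x} → i ∈ B → i ≢ x → i ∈ B ─ x
∈-─⁺ {B = B} {i} {x} i∈B i≢x = Vec.updateAt-minimal i x B i≢x i∈B

∈-─⁻ : ∀ {m} {B : Subset m} {i x} → i ∈ B ─ x → i ∈ B × i ≢ x
∈-─⁻ {B = B} {i} {x} i∈B─x with i ≟ x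
... | yes refl with () ← trans (≡-sym (Vec.[]=⇒lookup i∈B─x)) (Vec.lookup∘updateAt x B)
... | no i≢x =
  Vec.lookup⇒[]= i B (trans (≡-sym (Vec.lookup∘updateAt′ i x i≢x B)) (Vec.[]=⇒lookup i∈B─x)) , i≢x

x∉B─x : ∀ {m} {B : Subset m} {x} → x ∉ B ─ x
x∉B─x x∈B─x = proj₂ (∈-─⁻ x∈B─x) refl

─⊂ : ∀ {m} {B : Subset m} {x} → x ∈ B → B ─ x ⊂ B
─⊂ {x = x} x∈B = proj₁ ∘ ∈-─⁻ , x , x∈B , x∉B─x

_∈ᴸ?_ : ∀ {m} (i : Fin m) (xs : List (Fin m)) → Dec (i ∈ᴸ xs)
_∈ᴸ?_ {m} = DecMembership._∈?_ (_≟_ {m})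

fromList : ∀ {m} → List (Fin m) → Subset m
fromList xs = Vec.tabulate (λ i → ⌊ i ∈ᴸ? xs ⌋)

∈-fromList⁺ : ∀ {m} {xs : List (Fin m)} {i} → i ∈ᴸ xs → i ∈ fromList xs
∈-fromList⁺ {xs = xs} {i} i∈xs =
  Vec.lookup⇒[]= i _ (trans (Vec.lookup∘tabulate _ i) (⌊⌋-true (i ∈ᴸ? xs) i∈xs))

∈-fromList⁻ : ∀ {m} {xs : List (Fin m)} {i} → i ∈ fromList xs → i ∈ᴸ xs
∈-fromList⁻ {i = i} i∈ =
  toWitness (subst T (trans (≡-sym (Vec.[]=⇒lookup i∈)) (Vec.lookup∘tabulate _ i)) _)

module Paths {m} (K : Graph m) where

  adj-sym : ∀ {u w} → adj K u w ≡ true → adj K w u ≡ true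
  adj-sym {u} {w} = trans (Graph.sym K w u)

  reach-source : ∀ {B x y} → Reach K B x y → x ∈ B
  reach-source (here x∈B)     = x∈B
  reach-source (step x∈B _ _) = x∈B

  reach-target : ∀ {B x y} → Reach K B x y → y ∈ B
  reach-target (here y∈B)   = y∈B
  reach-target (step _ _ r) = reach-target r

  reach-trans : ∀ {B x y z} → Reach K B x y → Reach K B y z → Reach K B x z
  reach-trans (here _)       r′ = r′
  reach-trans (step x∈B e r) r′ = step x∈B e (reach-trans r r′)

  reach-sym : ∀ {B x y} → Reach K B x y → Reach K B y x
  reach-sym (here x∈B)     = here x∈B
  reach-sym (step x∈B e r) = reach-trans (reach-sym r) (step (reach-source r) (adj-sym e) (here x∈B))

  reach-mono : ∀ {B B′ x y} → B ⊆ B′ → Reach K B x y → Reach K B′ x y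
  reach-mono B⊆B′ (here x∈B)     = here (B⊆B′ x∈B)
  reach-mono B⊆B′ (step x∈B e r) = step (B⊆B′ x∈B) e (reach-mono B⊆B′ r)

  connectedOn-via : ∀ {C : Subset m} z → (∀ w → w ∈ C → Reach K C w z) → ConnectedOn K C
  connectedOn-via z reach-z u v u∈C v∈C = reach-trans (reach-z u u∈C) (reach-sym (reach-z v v∈C))

  data Path : Fin m → Fin m → Set where
    []  : ∀ u → Path u u
    _∷_ : ∀ {u w v} → adj K u w ≡ true → Path w v → Path u v

  vertices : ∀ {u v} → Path u v → List (Fin m)
  vertices ([] u)              = u ∷ []
  vertices (_∷_ {u = u} _ p) = u ∷ vertices p

  data Simple : ∀ {u v} → Path u v → Set where
    []  : ∀ u → Simple ([] u)
    _∷_ : ∀ {u w v} {e : adj K u w ≡ true} {p : Path w v} → u ∉ᴸ vertices p → Simple p → Simple (e ∷ p)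

  source∈ : ∀ {u v} (p : Path u v) → u ∈ᴸ vertices p
  source∈ ([] u)  = here refl
  source∈ (_ ∷ p) = here refl

  path⇒reach : ∀ {B u v} (p : Path u v) → (∀ {y} → y ∈ᴸ vertices p → y ∈ B) → Reach K B u v
  path⇒reach ([] u)  p⊆B = here (p⊆B (here refl))
  path⇒reach (e ∷ p) p⊆B = step (p⊆B (here refl)) e (path⇒reach p (p⊆B ∘ there))

  reach⇒path : ∀ {B x y} → Reach K B x y → Σ (Path x y) λ p → ∀ {z} → z ∈ᴸ vertices p → Reach K B x z
  reach⇒path (here {u} u∈B) = [] u , λ { (here refl) → here u∈B }
  reach⇒path (step u∈B e r) with reach⇒path r
  ... | p , reach = e ∷ p , λ { (here refl) → here u∈B ; (there z∈p) → step u∈B e (reach z∈p) }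

  suffix : ∀ {u v w} (p : Path u v) → w ∈ᴸ vertices p →
           Σ (Path w v) λ q → (vertices q ⊆ᴸ vertices p) × (Simple p → Simple q)
  suffix ([] u)  (here refl)  = [] u , id , id
  suffix (e ∷ p) (here refl)  = e ∷ p , id , id
  suffix (e ∷ p) (there w∈p) with suffix p w∈p
  ... | q , q⊆p , simple = q , there ∘ q⊆p , λ { (_ ∷ s) → simple s }

  _∷ʳ_ : ∀ {a b c} → Path a b → adj K b c ≡ true → Path a c
  [] a      ∷ʳ e = e ∷ [] _
  (e′ ∷ p) ∷ʳ e = e′ ∷ (p ∷ʳ e)

  ∈-∷ʳ⁻ : ∀ {a b c z} (p : Path a b) (e : adj K b c ≡ true) →
          z ∈ᴸ vertices (p ∷ʳ e) → z ∈ᴸ vertices p ⊎ z ≡ c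
  ∈-∷ʳ⁻ ([] a)   e (here refl)         = inj₁ (here refl)
  ∈-∷ʳ⁻ ([] a)   e (there (here refl)) = inj₂ refl
  ∈-∷ʳ⁻ (e′ ∷ p) e (here refl)         = inj₁ (here refl)
  ∈-∷ʳ⁻ (e′ ∷ p) e (there z∈)          = map₁ there (∈-∷ʳ⁻ p e z∈)

  ∷ʳ-⊆ : ∀ {a b c} {xs : List (Fin m)} (p : Path a b) (e : adj K b c ≡ true) →
         vertices p ⊆ᴸ xs → c ∈ᴸ xs → vertices (p ∷ʳ e) ⊆ᴸ xs
  ∷ʳ-⊆ p e p⊆xs c∈xs z∈ with ∈-∷ʳ⁻ p e z∈
  ... | inj₁ z∈p  = p⊆xs z∈p
  ... | inj₂ refl = c∈xs

  reverse : ∀ {a b} (p : Path a b) → Σ (Path b a) λ q → vertices q ⊆ᴸ vertices p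
  reverse ([] a)                = [] a , id
  reverse (e ∷ p) with reverse p
  ... | q , q⊆p = q ∷ʳ adj-sym e , ∷ʳ-⊆ q (adj-sym e) (there ∘ q⊆p) (here refl)

  simplify : ∀ {a b} (p : Path a b) → Σ (Path a b) λ q → Simple q × (vertices q ⊆ᴸ vertices p)
  simplify ([] a) = [] a , [] a , id
  simplify (_∷_ {u = a} e p) with simplify p
  ... | q , simple-q , q⊆p with a ∈ᴸ? vertices q
  ...   | yes a∈q = let r , r⊆q , simple = suffix q a∈q in r , simple simple-q , there ∘ q⊆p ∘ r⊆q
  ...   | no a∉q  =
    e ∷ q , a∉q ∷ simple-q , λ { (here refl) → here refl ; (there z∈q) → there (q⊆p z∈q) }

  Avoiding : Fin m → Fin m → Fin m → List (Fin m) → Set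
  Avoiding x w z xs = Σ (Path w z) λ q → (vertices q ⊆ᴸ xs) × x ∉ᴸ vertices q

  to-an-end-avoiding : ∀ {a b x w} {p : Path a b} → Simple p → w ∈ᴸ vertices p → w ≢ x →
           Avoiding x w a (vertices p) ⊎ Avoiding x w b (vertices p)
  to-an-end-avoiding ([] a)  (here refl) w≢x = inj₁ ([] a , id , λ { (here x≡w) → w≢x (≡-sym x≡w) })
  to-an-end-avoiding (_ ∷ _) (here refl) w≢x =
    inj₁ ([] _ , (λ { (here refl) → here refl }) , λ { (here x≡w) → w≢x (≡-sym x≡w) })
  to-an-end-avoiding {a} {x = x} {p = e ∷ p} (a∉p ∷ simple) (there w∈p) w≢x
    with to-an-end-avoiding simple w∈p w≢x
  ... | inj₂ (q , q⊆p , x∉q) = inj₂ (q , there ∘ q⊆p , x∉q)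
  ... | inj₁ (q , q⊆p , x∉q) with a ≟ x
  ...   | yes refl = let r , r⊆p , _ = suffix p w∈p in inj₂ (r , there ∘ r⊆p , a∉p ∘ r⊆p)
  ...   | no a≢x   = inj₁ (q ∷ʳ adj-sym e , ∷ʳ-⊆ q (adj-sym e) (there ∘ q⊆p) (here refl) , x∉q∷ʳa)
    where
      x∉q∷ʳa : x ∉ᴸ vertices (q ∷ʳ adj-sym e)
      x∉q∷ʳa x∈ with ∈-∷ʳ⁻ q (adj-sym e) x∈
      ... | inj₁ x∈q = x∉q x∈q
      ... | inj₂ x≡a = a≢x (≡-sym x≡a)

module Cycle {m} (K : Graph m) {a b : Fin m} {P Q : Paths.Path K a b}
  (simple-P : Paths.Simple K P) (simple-Q : Paths.Simple K Q)
  (internally-disjoint : ∀ {z} → z ∈ᴸ Paths.vertices K P → z ∈ᴸ Paths.vertices K Q → z ≡ a ⊎ z ≡ b)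
  where
  open Paths K

  vertexSet : Subset m
  vertexSet = fromList (vertices P ++ vertices Q)

  ∈-vertexSetˡ : ∀ {y} → y ∈ᴸ vertices P → y ∈ vertexSet
  ∈-vertexSetˡ = ∈-fromList⁺ ∘ ∈-++⁺ˡ

  ∈-vertexSetʳ : ∀ {y} → y ∈ᴸ vertices Q → y ∈ vertexSet
  ∈-vertexSetʳ = ∈-fromList⁺ ∘ ∈-++⁺ʳ (vertices P)

  private
    B = vertexSet

  avoiding⇒reach : ∀ {x w z xs} → (∀ {y} → y ∈ᴸ xs → y ∈ B) → Avoiding x w z xs → Reach K (B ─ x) w z
  avoiding⇒reach xs⊆B (q , q⊆xs , x∉q) =
    path⇒reach q (λ y∈q → ∈-─⁺ (xs⊆B (q⊆xs y∈q)) λ { refl → x∉q y∈q })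

  reach-an-end : ∀ {w x} → w ∈ B ─ x → Reach K (B ─ x) w a ⊎ Reach K (B ─ x) w b
  reach-an-end w∈B─x with ∈-─⁻ w∈B─x
  ... | w∈B , w≢x with ∈-++⁻ (vertices P) (∈-fromList⁻ w∈B)
  ...   | inj₁ w∈P = ⊎-map (avoiding⇒reach ∈-vertexSetˡ) (avoiding⇒reach ∈-vertexSetˡ)
                           (to-an-end-avoiding simple-P w∈P w≢x)
  ...   | inj₂ w∈Q = ⊎-map (avoiding⇒reach ∈-vertexSetʳ) (avoiding⇒reach ∈-vertexSetʳ)
                           (to-an-end-avoiding simple-Q w∈Q w≢x)

  not-on-both : ∀ {x} → x ≢ a → x ≢ b → x ∈ᴸ vertices P → x ∉ᴸ vertices Q
  not-on-both x≢a x≢b x∈P x∈Q = [ x≢a , x≢b ] (internally-disjoint x∈P x∈Q)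

  reach-b-a : ∀ {x} → x ∈ B → x ≢ a → x ≢ b → Reach K (B ─ x) b a
  reach-b-a x∈B x≢a x≢b with ∈-++⁻ (vertices P) (∈-fromList⁻ x∈B)
  ... | inj₁ x∈P = let q , q⊆Q = reverse Q in
    avoiding⇒reach ∈-vertexSetʳ (q , q⊆Q , not-on-both x≢a x≢b x∈P ∘ q⊆Q)
  ... | inj₂ x∈Q = let q , q⊆P = reverse P in
    avoiding⇒reach ∈-vertexSetˡ (q , q⊆P , λ x∈q → not-on-both x≢a x≢b (q⊆P x∈q) x∈Q)

  connected-without : ∀ x → x ∈ B → ConnectedOn K (B ─ x)
  connected-without x x∈B with x ≟ a | x ≟ b
  ... | yes refl | _ =
    connectedOn-via b λ _ w∈ → [ ⊥-elim ∘ x∉B─x ∘ reach-target , id ] (reach-an-end w∈)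
  ... | no _ | yes refl =
    connectedOn-via a λ _ w∈ → [ id , ⊥-elim ∘ x∉B─x ∘ reach-target ] (reach-an-end w∈)
  ... | no x≢a | no x≢b =
    connectedOn-via a λ _ w∈ → [ id , (λ r → reach-trans r (reach-b-a x∈B x≢a x≢b)) ] (reach-an-end w∈)

  connected : ConnectedOn K B
  connected = connectedOn-via a reach-a
    where
      reach-a : ∀ w → w ∈ B → Reach K B w a
      reach-a w w∈B with w ≟ b
      ... | yes refl = let q , q⊆P = reverse P in path⇒reach q (∈-vertexSetˡ ∘ q⊆P)
      ... | no w≢b   =
        [ reach-mono (proj₁ ∘ ∈-─⁻) , ⊥-elim ∘ x∉B─x ∘ reach-target ] (reach-an-end (∈-─⁺ w∈B w≢b))

  biconnected : Biconnected K B
  biconnected = connected , connected-without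

module BlockGraph {m} (H : Graph m) (block-graph : IsBlockGraph H) where

  -- If no block contained B, B would itself be a block: by induction on m ∸ ∣ B ∣ every proper
  -- biconnected superset lies in a block. Maximality is not decidable, hence the double negation.
  biconnected⇒¬¬⊆block : ∀ k (B : Subset m) → m ∸ ∣ B ∣ ℕ.≤ k → Biconnected H B →
                          ¬ ¬ (Σ (Subset m) λ C → IsBlock H C × B ⊆ C)
  biconnected⇒¬¬⊆block ℕ.zero B m≤∣B∣ biconnected-B no-block =
    no-block (B , (biconnected-B , no-proper-superset) , id)
    where
      no-proper-superset : ∀ C → B ⊂ C → ¬ Biconnected H C
      no-proper-superset C B⊂C _ = ℕ.<-irrefl refl (begin-strict
        ∣ B ∣ <⟨ Subset.p⊂q⇒∣p∣<∣q∣ B⊂C ⟩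
        ∣ C ∣ ≤⟨ Subset.∣p∣≤n C ⟩
        m     ≤⟨ ℕ.m∸n≡0⇒m≤n (ℕ.n≤0⇒n≡0 m≤∣B∣) ⟩
        ∣ B ∣ ∎)
        where open ℕ.≤-Reasoning
  biconnected⇒¬¬⊆block (suc k) B m∸∣B∣≤1+k biconnected-B no-block =
    no-block (B , (biconnected-B , no-proper-superset) , id)
    where
      no-proper-superset : ∀ C → B ⊂ C → ¬ Biconnected H C
      no-proper-superset C B⊂C biconnected-C =
        biconnected⇒¬¬⊆block k C m∸∣C∣≤k biconnected-C
          λ { (D , D-block , C⊆D) → no-block (D , D-block , C⊆D ∘ proj₁ B⊂C) }
        where
          m∸∣C∣≤k : m ∸ ∣ C ∣ ℕ.≤ k
          m∸∣C∣≤k = ℕ.≤-pred (ℕ.<-≤-trans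
            (ℕ.∸-monoʳ-< (Subset.p⊂q⇒∣p∣<∣q∣ B⊂C) (Subset.∣p∣≤n C)) m∸∣B∣≤1+k)

  biconnected⇒¬¬clique : ∀ B → Biconnected H B → ¬ ¬ IsClique H B
  biconnected⇒¬¬clique B biconnected-B not-clique =
    biconnected⇒¬¬⊆block m B (ℕ.m∸n≤m m ∣ B ∣) biconnected-B λ { (C , C-block , B⊆C) →
      not-clique λ u v u∈B v∈B → proj₂ block-graph C C-block u v (B⊆C u∈B) (B⊆C v∈B) }

record TrueTwins {n} (G : Graph n) (v w : Fin n) : Set where
  field
    adjacent        : adj G v w ≡ true
    same-neighbours : ∀ i → i ≢ v → i ≢ w → adj G i v ≡ adj G i w

adjacent⇒≢ : ∀ {n} (G : Graph n) {v w} → adj G v w ≡ true → v ≢ w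
adjacent⇒≢ G {v} v∼w refl with () ← trans (≡-sym v∼w) (irrefl G v)

module Blowup {n m} (G : Graph n) (H : Graph m) (f : Fin n → Fin m)
  (adj-G : ∀ i j → adj G i j ≡ (not ⌊ i ≟ j ⌋ ∧ (⌊ f i ≟ f j ⌋ ∨ adj H (f i) (f j)))) where
  open Paths G
  module InH = Paths H

  sameClass⇒adj : ∀ {w z} → w ≢ z → f w ≡ f z → adj G w z ≡ true
  sameClass⇒adj {w} {z} w≢z fw≡fz rewrite adj-G w z with w ≟ z | f w ≟ f z
  ... | yes w≡z | _        = ⊥-elim (w≢z w≡z)
  ... | no _    | yes _    = refl
  ... | no _    | no fw≢fz = ⊥-elim (fw≢fz fw≡fz)

  adjᴴ⇒adj : ∀ {w z} → w ≢ z → adj H (f w) (f z) ≡ true → adj G w z ≡ true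
  adjᴴ⇒adj {w} {z} w≢z e rewrite adj-G w z with w ≟ z | f w ≟ f z
  ... | yes w≡z | _     = ⊥-elim (w≢z w≡z)
  ... | no _    | yes _ = refl
  ... | no _    | no _  = e

  adj⇒adjᴴ : ∀ {w z} → adj G w z ≡ true → f w ≢ f z → adj H (f w) (f z) ≡ true
  adj⇒adjᴴ {w} {z} e fw≢fz rewrite adj-G w z with w ≟ z | f w ≟ f z
  ... | yes _ | _         with () ← e
  ... | no _  | yes fw≡fz = ⊥-elim (fw≢fz fw≡fz)
  ... | no _  | no _      = e

  adj-of-sameClass : ∀ {w y z} → f w ≡ f y → adj G y z ≡ true → w ≢ z → adj G w z ≡ true
  adj-of-sameClass {w} {y} {z} fw≡fy e w≢z with f y ≟ f z
  ... | yes fy≡fz = sameClass⇒adj w≢z (trans fw≡fy fy≡fz)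
  ... | no fy≢fz  = adjᴴ⇒adj w≢z (subst (λ h → adj H h (f z) ≡ true) (≡-sym fw≡fy) (adj⇒adjᴴ e fy≢fz))

  sameClass⇒trueTwins : ∀ {s t} → s ≢ t → f s ≡ f t → TrueTwins G s t
  sameClass⇒trueTwins {s} {t} s≢t fs≡ft = record
    { adjacent = sameClass⇒adj s≢t fs≡ft ; same-neighbours = same-neighbours }
    where
      same-neighbours : ∀ i → i ≢ s → i ≢ t → adj G i s ≡ adj G i t
      same-neighbours i i≢s i≢t rewrite adj-G i s | adj-G i t | fs≡ft with i ≟ s | i ≟ t
      ... | yes i≡s | _       = ⊥-elim (i≢s i≡s)
      ... | no _    | yes i≡t = ⊥-elim (i≢t i≡t)
      ... | no _    | no _    = refl

  Image : (Fin n → Set) → Fin m → Set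
  Image P h = Σ (Fin n) λ z → P z × f z ≡ h

  project : ∀ {x y} (p : Path x y) → Σ (InH.Path (f x) (f y)) λ q →
            ∀ {h} → h ∈ᴸ InH.vertices q → Image (_∈ᴸ vertices p) h
  project ([] x) = InH.[] (f x) , λ { (here refl) → x , here refl , refl }
  project (_∷_ {u = x} {w} e p) with project p | f x ≟ f w
  ... | q , q⊆p | yes fx≡fw rewrite fx≡fw =
    q , λ h∈q → let z , z∈p , fz≡h = q⊆p h∈q in z , there z∈p , fz≡h
  ... | q , q⊆p | no fx≢fw = adj⇒adjᴴ e fx≢fw InH.∷ q , λ
    { (here refl) → x , here refl , refl
    ; (there h∈q) → let z , z∈p , fz≡h = q⊆p h∈q in z , there z∈p , fz≡h }

  module _ (S : Subset n) where

    Component : Fin n → Fin n → Set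
    Component c = Reach G (∁ S) c

    NeighbourIn : Fin n → Fin n → Set
    NeighbourIn c s = Σ (Fin n) λ p → Component c p × adj G s p ≡ true

    Full : Fin n → Fin n → Fin n → Set
    Full u v s = NeighbourIn u s × NeighbourIn v s

    module Separated {c c′} (separated : ¬ Component c c′) where

      disjoint : ∀ {w} → Component c w → Component c′ w → ⊥
      disjoint r r′ = separated (reach-trans r (reach-sym r′))

      no-edge : ∀ {w w′} → Component c w → Component c′ w′ → adj G w w′ ≡ true → ⊥
      no-edge r r′ e = disjoint (reach-trans r (step (reach-target r) e (here (reach-target r′)))) r′

      distinct : ∀ {w w′} → Component c w → Component c′ w′ → w ≢ w′
      distinct r r′ refl = disjoint r r′

      images-separated : ∀ {h h′} → Image (Component c) h → Image (Component c′) h′ →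
                         h ≢ h′ × adj H h h′ ≡ false
      images-separated (w , r , refl) (w′ , r′ , refl) =
        (λ fw≡fw′ → no-edge r r′ (sameClass⇒adj (distinct r r′) fw≡fw′)) , non-adjacent
        where
          non-adjacent : adj H (f w) (f w′) ≡ false
          non-adjacent with adj H (f w) (f w′) in e
          ... | true  = ⊥-elim (no-edge r r′ (adjᴴ⇒adj (distinct r r′) e))
          ... | false = refl

      class-outside : ∀ {w s} → Component c w → NeighbourIn c′ s → f w ≢ f s
      class-outside r (_ , r′ , e) fw≡fs = no-edge r r′ (adj-of-sameClass fw≡fs e (distinct r r′))

      record Detour (s t : Fin n) : Set where
        field
          path        : InH.Path (f s) (f t)
          simple      : InH.Simple path
          through     : ∀ {h} → h ∈ᴸ InH.vertices path → h ≡ f s ⊎ h ≡ f t ⊎ Image (Component c) h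
          inner       : Fin m
          inner∈      : inner ∈ᴸ InH.vertices path
          inner-image : Image (Component c) inner

      detour : ∀ {s t} → NeighbourIn c s → NeighbourIn c t → NeighbourIn c′ s → f s ≢ f t → Detour s t
      detour {s} {t} (p , c∼p , s∼p) (q , c∼q , t∼q) s-outside fs≢ft = record
        { path        = s∼pᴴ InH.∷ walkᴴ
        ; simple      = fs∉walkᴴ InH.∷ simple-walkᴴ
        ; through     = λ { (here h≡fs) → inj₁ h≡fs ; (there h∈) → inj₂ (swap (walkᴴ-through h∈)) }
        ; inner       = f p
        ; inner∈      = there (InH.source∈ walkᴴ)
        ; inner-image = p , c∼p , refl
        }
        where
          inside : Σ (Path p q) λ w → ∀ {z} → z ∈ᴸ vertices w → Component p z
          inside = reach⇒path (reach-trans (reach-sym c∼p) c∼q)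

          walk : Path p t
          walk = proj₁ inside ∷ʳ adj-sym t∼q

          walk-through : ∀ {z} → z ∈ᴸ vertices walk → Component c z ⊎ z ≡ t
          walk-through = map₁ (reach-trans c∼p ∘ proj₂ inside) ∘ ∈-∷ʳ⁻ (proj₁ inside) (adj-sym t∼q)

          simplified : Σ (InH.Path (f p) (f t)) λ q →
                       InH.Simple q × (InH.vertices q ⊆ᴸ InH.vertices (proj₁ (project walk)))
          simplified = InH.simplify (proj₁ (project walk))

          walkᴴ : InH.Path (f p) (f t)
          walkᴴ = proj₁ simplified

          simple-walkᴴ : InH.Simple walkᴴ
          simple-walkᴴ = proj₁ (proj₂ simplified)

          walkᴴ-through : ∀ {h} → h ∈ᴸ InH.vertices walkᴴ → Image (Component c) h ⊎ h ≡ f t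
          walkᴴ-through h∈ with proj₂ (project walk) (proj₂ (proj₂ simplified) h∈)
          ... | z , z∈ , refl with walk-through z∈
          ...   | inj₁ c∼z = inj₁ (z , c∼z , refl)
          ...   | inj₂ refl = inj₂ refl

          s∼pᴴ : adj H (f s) (f p) ≡ true
          s∼pᴴ = adj⇒adjᴴ s∼p (≢-sym (class-outside c∼p s-outside))

          fs∉walkᴴ : f s ∉ᴸ InH.vertices walkᴴ
          fs∉walkᴴ fs∈ with walkᴴ-through fs∈
          ... | inj₁ (w , c∼w , fw≡fs) = class-outside c∼w s-outside fw≡fs
          ... | inj₂ fs≡ft             = fs≢ft fs≡ft

    full⇒sameClass : IsBlockGraph H → ∀ {u v s t} → ¬ Component u v → Full u v s → Full u v t →
                     f s ≡ f t
    full⇒sameClass block-graph {u} {v} {s} {t} separated (u∼s , v∼s) (u∼t , v∼t) with f s ≟ f t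
    ... | yes fs≡ft = fs≡ft
    ... | no fs≢ft  =
      ⊥-elim (BlockGraph.biconnected⇒¬¬clique H block-graph _ cycle.biconnected cycle-not-clique)
      where
        module U = Separated separated
        module V = Separated (separated ∘ reach-sym)
        module Dᵤ = U.Detour (U.detour u∼s u∼t v∼s fs≢ft)
        module Dᵥ = V.Detour (V.detour v∼s v∼t u∼s fs≢ft)

        internally-disjoint : ∀ {h} → h ∈ᴸ InH.vertices Dᵤ.path → h ∈ᴸ InH.vertices Dᵥ.path →
                              h ≡ f s ⊎ h ≡ f t
        internally-disjoint h∈u h∈v with Dᵤ.through h∈u | Dᵥ.through h∈v
        ... | inj₁ h≡fs         | _                 = inj₁ h≡fs
        ... | inj₂ (inj₁ h≡ft)  | _                 = inj₂ h≡ft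
        ... | inj₂ (inj₂ _)     | inj₁ h≡fs         = inj₁ h≡fs
        ... | inj₂ (inj₂ _)     | inj₂ (inj₁ h≡ft)  = inj₂ h≡ft
        ... | inj₂ (inj₂ h∈ᵤ)   | inj₂ (inj₂ h∈ᵥ)   = ⊥-elim (proj₁ (U.images-separated h∈ᵤ h∈ᵥ) refl)

        module cycle = Cycle H Dᵤ.simple Dᵥ.simple internally-disjoint

        cycle-not-clique : ¬ IsClique H cycle.vertexSet
        cycle-not-clique clique with U.images-separated Dᵤ.inner-image Dᵥ.inner-image
        ... | distinct , non-adjacent with () ← trans (≡-sym non-adjacent)
          (clique _ _ (cycle.∈-vertexSetˡ Dᵤ.inner∈) (cycle.∈-vertexSetʳ Dᵥ.inner∈) distinct)

    neighbour-on-exit : ∀ {s x y} → x ∉ S → Reach G (∁ (S ─ s)) x y → ¬ Component x y → NeighbourIn x s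
    neighbour-on-exit x∉S (here _) x≁y = ⊥-elim (x≁y (here (Subset.x∉p⇒x∈∁p x∉S)))
    neighbour-on-exit {s} x∉S (step {w = w} _ e r) x≁y with w ≟ s
    ... | yes refl = _ , here (Subset.x∉p⇒x∈∁p x∉S) , adj-sym e
    ... | no w≢s   =
      let p , w∼p , s∼p = neighbour-on-exit w∉S r (x≁y ∘ step (Subset.x∉p⇒x∈∁p x∉S) e)
      in p , step (Subset.x∉p⇒x∈∁p x∉S) e w∼p , s∼p
      where
        w∉S : w ∉ S
        w∉S w∈S = Subset.x∈∁p⇒x∉p (reach-source r) (∈-─⁺ w∈S w≢s)

    -- Minimality makes S ─ s fail to separate u and v; a u–v path avoiding S ─ s must pass
    -- through s, and the vertices just before and after it are the required neighbours.
    minimalSeparator⇒¬¬full : ∀ {u v s} → IsMinimalSeparator G S u v → s ∈ S → ¬ ¬ Full u v s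
    minimalSeparator⇒¬¬full ((u∉S , v∉S , u≁v) , minimal) s∈S not-full =
      minimal (S ─ _) (─⊂ s∈S) (u∉S ∘ proj₁ ∘ ∈-─⁻ , v∉S ∘ proj₁ ∘ ∈-─⁻ , λ u∼v → not-full
        (neighbour-on-exit u∉S u∼v u≁v , neighbour-on-exit v∉S (reach-sym u∼v) (u≁v ∘ reach-sym)))

    minimalSeparator⇒sameClass : IsBlockGraph H → ∀ {u v s t} → IsMinimalSeparator G S u v →
                                 s ∈ S → t ∈ S → f s ≡ f t
    minimalSeparator⇒sameClass block-graph separator s∈S t∈S =
      decidable-stable (f _ ≟ f _) λ fs≢ft →
        minimalSeparator⇒¬¬full separator s∈S λ full-s →
        minimalSeparator⇒¬¬full separator t∈S λ full-t →
        fs≢ft (full⇒sameClass block-graph (proj₂ (proj₂ (proj₁ separator))) full-s full-t)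

indicator : Bool → ℕ
indicator b = if b then 1 else 0

sumℕ-cong : ∀ {k} {g h : Fin k → ℕ} → (∀ j → g j ≡ h j) → sumℕ g ≡ sumℕ h
sumℕ-cong {ℕ.zero}  g≗h = refl
sumℕ-cong {suc k} g≗h = cong₂ ℕ._+_ (g≗h zero) (sumℕ-cong (g≗h ∘ suc))

sumℕ-+ : ∀ {k} (g h : Fin k → ℕ) → sumℕ (λ j → g j ℕ.+ h j) ≡ sumℕ g ℕ.+ sumℕ h
sumℕ-+ {ℕ.zero}  g h = refl
sumℕ-+ {suc k} g h = trans (cong (g zero ℕ.+ h zero ℕ.+_) (sumℕ-+ (g ∘ suc) (h ∘ suc)))
  (+-interchange (g zero) (h zero) (sumℕ (g ∘ suc)) (sumℕ (h ∘ suc)))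

sumℕ-0 : ∀ k → sumℕ {k} (λ _ → 0) ≡ 0
sumℕ-0 ℕ.zero  = refl
sumℕ-0 (suc k) = sumℕ-0 k

⌊suc≟suc⌋ : ∀ {k} (i j : Fin k) → ⌊ suc i ≟ suc j ⌋ ≡ ⌊ i ≟ j ⌋
⌊suc≟suc⌋ i j = ⌊⌋-map′ _ _ (i ≟ j)

sumℕ-indicator : ∀ {k} (a : Fin k) → sumℕ (λ j → indicator ⌊ j ≟ a ⌋) ≡ 1
sumℕ-indicator {suc k} zero = cong suc (sumℕ-0 k)
sumℕ-indicator (suc a)      = trans (sumℕ-cong λ j → cong indicator (⌊suc≟suc⌋ j a)) (sumℕ-indicator a)

-- Both sums count the closed neighbourhood N[v] = N[w].
trueTwins-degree : ∀ {n} (G : Graph n) {v w} → TrueTwins G v w → degree G v ≡ degree G w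
trueTwins-degree G {v} {w} twins = ℕ.suc-injective (begin
  suc (degree G v)                                  ≡⟨ cong (ℕ._+ degree G v) (≡-sym (sumℕ-indicator v)) ⟩
  sumℕ (closed v) ℕ.+ degree G v                    ≡⟨ ≡-sym (sumℕ-+ (closed v) _) ⟩
  sumℕ (λ j → closed v j ℕ.+ indicator (adj G v j)) ≡⟨ sumℕ-cong closed-neighbourhoods ⟩
  sumℕ (λ j → closed w j ℕ.+ indicator (adj G w j)) ≡⟨ sumℕ-+ (closed w) _ ⟩
  sumℕ (closed w) ℕ.+ degree G w                    ≡⟨ cong (ℕ._+ degree G w) (sumℕ-indicator w) ⟩
  suc (degree G w)                                  ∎)
  where
    open ≡-Reasoning
    open TrueTwins twins

    closed : Fin _ → Fin _ → ℕ
    closed a j = indicator ⌊ j ≟ a ⌋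

    w∼v : adj G w v ≡ true
    w∼v = trans (Graph.sym G w v) adjacent

    closed-neighbourhoods : ∀ j → closed v j ℕ.+ indicator (adj G v j) ≡ closed w j ℕ.+ indicator (adj G w j)
    closed-neighbourhoods j with j ≟ v | j ≟ w
    ... | yes refl | yes refl = ⊥-elim (adjacent⇒≢ G adjacent refl)
    ... | yes refl | no _     rewrite irrefl G j | w∼v = refl
    ... | no _     | yes refl rewrite irrefl G j | adjacent = refl
    ... | no j≢v   | no j≢w   =
      cong indicator (trans (Graph.sym G v j) (trans (same-neighbours j j≢v j≢w) (Graph.sym G j w)))

ℕtoℚ-suc : ∀ k → ℕtoℚ (suc k) ≡ ℕtoℚ k + 1ℚ
ℕtoℚ-suc k = ℚ.toℚᵘ-injective (ℚᵘ.≃-trans unnormalised (ℚᵘ.≃-sym (ℚ.toℚᵘ-homo-+ (ℕtoℚ k) 1ℚ)))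
  where
    unnormalised : ℚᵘ.mkℚᵘ (ℤ.+ suc k) 0 ℚᵘ.≃ ℚᵘ.mkℚᵘ (ℤ.+ k) 0 ℚᵘ.+ ℚᵘ.mkℚᵘ 1ℤ 0
    unnormalised = ℚᵘ.*≡* (trans (cong (ℤ._* (1ℤ ℤ.* 1ℤ)) (ℤ.pos-+ 1 k)) (cross-multiplied (ℤ.+ k)))
      where
        cross-multiplied : ∀ a → (1ℤ ℤ.+ a) ℤ.* (1ℤ ℤ.* 1ℤ) ≡ (a ℤ.* 1ℤ ℤ.+ 1ℤ ℤ.* 1ℤ) ℤ.* 1ℤ
        cross-multiplied = solve-∀

sumℚ-zero : ∀ {k} (h : Fin k → ℚ) → (∀ j → h j ≡ 0ℚ) → sumℚ h ≡ 0ℚ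
sumℚ-zero {ℕ.zero} h h≗0 = refl
sumℚ-zero {suc k}  h h≗0 = cong₂ _+_ (h≗0 zero) (sumℚ-zero (h ∘ suc) (h≗0 ∘ suc))

sumℚ-single : ∀ {k} (a : Fin k) (h : Fin k → ℚ) → (∀ j → j ≢ a → h j ≡ 0ℚ) → sumℚ h ≡ h a
sumℚ-single zero    h h≗0 =
  trans (cong (h zero +_) (sumℚ-zero (h ∘ suc) (λ j → h≗0 (suc j) λ ()))) (ℚ.+-identityʳ (h zero))
sumℚ-single (suc a) h h≗0 =
  trans (cong₂ _+_ (h≗0 zero λ ()) (sumℚ-single a (h ∘ suc) λ j j≢a → h≗0 (suc j) (j≢a ∘ Fin.suc-injective)))
        (ℚ.+-identityˡ (h (suc a)))

sumℚ-pair : ∀ {k} (a b : Fin k) → a ≢ b → (h : Fin k → ℚ) → (∀ j → j ≢ a → j ≢ b → h j ≡ 0ℚ) →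
            sumℚ h ≡ h a + h b
sumℚ-pair zero    zero    a≢b h h≗0 = ⊥-elim (a≢b refl)
sumℚ-pair zero    (suc b) a≢b h h≗0 =
  cong (h zero +_) (sumℚ-single b (h ∘ suc) λ j j≢b → h≗0 (suc j) (λ ()) (j≢b ∘ Fin.suc-injective))
sumℚ-pair (suc a) zero    a≢b h h≗0 =
  trans (cong (h zero +_) (sumℚ-single a (h ∘ suc) λ j j≢a → h≗0 (suc j) (j≢a ∘ Fin.suc-injective) (λ ())))
        (ℚ.+-comm (h zero) (h (suc a)))
sumℚ-pair (suc a) (suc b) a≢b h h≗0 =
  trans (cong₂ _+_ (h≗0 zero (λ ()) (λ ()))
                   (sumℚ-pair a b (a≢b ∘ cong suc) (h ∘ suc)
                      λ j j≢a j≢b → h≗0 (suc j) (j≢a ∘ Fin.suc-injective) (j≢b ∘ Fin.suc-injective)))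
        (ℚ.+-identityˡ _)

record Enumeration {k} (p : Subset k) : Set where
  field
    element            : Fin ∣ p ∣ → Fin k
    element∈           : ∀ r → element r ∈ p
    element-injective  : ∀ {r r′} → element r ≡ element r′ → r ≡ r′
    element-surjective : ∀ {x} → x ∈ p → Σ (Fin ∣ p ∣) λ r → element r ≡ x

enumerate : ∀ {k} (p : Subset k) → Enumeration p
enumerate Vec.[] = record
  { element            = λ ()
  ; element∈           = λ ()
  ; element-injective  = λ {r} → ⊥-elim (Fin.¬Fin0 r)
  ; element-surjective = λ ()
  }
enumerate (true Vec.∷ p) = record
  { element            = λ { zero → zero ; (suc r) → suc (element r) }
  ; element∈           = λ { zero → Vec.here ; (suc r) → Vec.there (element∈ r) }
  ; element-injective  = λ { {zero} {zero} _ → refl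
                           ; {suc r} {suc r′} e → cong suc (element-injective (Fin.suc-injective e)) }
  ; element-surjective = λ { {zero} _ → zero , refl
                           ; {suc x} (Vec.there x∈p) → let r , e = element-surjective x∈p in suc r , cong suc e }
  }
  where open Enumeration (enumerate p)
enumerate (false Vec.∷ p) = record
  { element            = suc ∘ element
  ; element∈           = Vec.there ∘ element∈
  ; element-injective  = element-injective ∘ Fin.suc-injective
  ; element-surjective = λ { {suc x} (Vec.there x∈p) → let r , e = element-surjective x∈p in r , cong suc e }
  }
  where open Enumeration (enumerate p)

module Laplacian {n} (G : Graph n) where
  open +-*-Solver

  unit : Fin n → Fin n → ℚ
  unit a j = if ⌊ j ≟ a ⌋ then 1ℚ else 0ℚ

  unit-self : ∀ a → unit a a ≡ 1ℚ
  unit-self a rewrite ⌊⌋-true (a ≟ a) refl = refl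

  unit-other : ∀ {a j} → j ≢ a → unit a j ≡ 0ℚ
  unit-other {a} {j} j≢a rewrite ⌊⌋-false (j ≟ a) j≢a = refl

  twinVector : Fin n → Fin n → Fin n → ℚ
  twinVector v w j = unit v j - unit w j

  twinVector-other : ∀ {v w j} → j ≢ v → j ≢ w → twinVector v w j ≡ 0ℚ
  twinVector-other j≢v j≢w = cong₂ _-_ (unit-other j≢v) (unit-other j≢w)

  laplacian-diagonal : ∀ i → laplacian G i i ≡ ℕtoℚ (degree G i)
  laplacian-diagonal i rewrite ⌊⌋-true (i ≟ i) refl = refl

  laplacian-offDiagonal : ∀ {i j} → i ≢ j → laplacian G i j ≡ (if adj G i j then - 1ℚ else 0ℚ)
  laplacian-offDiagonal {i} {j} i≢j rewrite ⌊⌋-false (i ≟ j) i≢j = refl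

  laplacian-adjacent : ∀ {i j} → adj G i j ≡ true → laplacian G i j ≡ - 1ℚ
  laplacian-adjacent i∼j =
    trans (laplacian-offDiagonal (adjacent⇒≢ G i∼j)) (cong (if_then - 1ℚ else 0ℚ) i∼j)

  module _ {v w} (twins : TrueTwins G v w) where
    open TrueTwins twins
    open ≡-Reasoning

    private
      L = laplacian G
      x = twinVector v w
      d = ℕtoℚ (degree G v)
      v≢w = adjacent⇒≢ G adjacent

      x-at-v : x v ≡ 1ℚ
      x-at-v = cong₂ _-_ (unit-self v) (unit-other v≢w)

      x-at-w : x w ≡ - 1ℚ
      x-at-w = cong₂ _-_ (unit-other (≢-sym v≢w)) (unit-self w)

      L-v-w : L v w ≡ - 1ℚ
      L-v-w = laplacian-adjacent adjacent

      L-w-v : L w v ≡ - 1ℚ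
      L-w-v = laplacian-adjacent (trans (Graph.sym G w v) adjacent)

    row : ∀ i → Dec (i ≡ v) → Dec (i ≡ w) → L i v * 1ℚ + L i w * - 1ℚ ≡ (d + 1ℚ) * x i
    row i (yes refl) _ = begin
      L i i * 1ℚ + L i w * - 1ℚ  ≡⟨ cong₂ (λ a b → a * 1ℚ + b * - 1ℚ) (laplacian-diagonal i) L-v-w ⟩
      d * 1ℚ + - 1ℚ * - 1ℚ       ≡⟨ at-v d ⟩
      (d + 1ℚ) * 1ℚ              ≡⟨ cong ((d + 1ℚ) *_) (≡-sym x-at-v) ⟩
      (d + 1ℚ) * x i             ∎
      where
        at-v : ∀ a → a * 1ℚ + - 1ℚ * - 1ℚ ≡ (a + 1ℚ) * 1ℚ
        at-v = solve 1 (λ a → a :* con 1ℚ :+ (:- con 1ℚ) :* (:- con 1ℚ)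
                           := (a :+ con 1ℚ) :* con 1ℚ) refl
    row i (no _) (yes refl) = begin
      L i v * 1ℚ + L i i * - 1ℚ              ≡⟨ cong₂ (λ a b → a * 1ℚ + b * - 1ℚ) L-w-v (laplacian-diagonal i) ⟩
      - 1ℚ * 1ℚ + ℕtoℚ (degree G i) * - 1ℚ  ≡⟨ cong (λ k → - 1ℚ * 1ℚ + ℕtoℚ k * - 1ℚ) degree-w≡degree-v ⟩
      - 1ℚ * 1ℚ + d * - 1ℚ                  ≡⟨ at-w d ⟩
      (d + 1ℚ) * - 1ℚ                       ≡⟨ cong ((d + 1ℚ) *_) (≡-sym x-at-w) ⟩
      (d + 1ℚ) * x i                        ∎
      where
        degree-w≡degree-v : degree G i ≡ degree G v
        degree-w≡degree-v = ≡-sym (trueTwins-degree G twins)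
        at-w : ∀ a → - 1ℚ * 1ℚ + a * - 1ℚ ≡ (a + 1ℚ) * - 1ℚ
        at-w = solve 1 (λ a → (:- con 1ℚ) :* con 1ℚ :+ a :* (:- con 1ℚ)
                           := (a :+ con 1ℚ) :* (:- con 1ℚ)) refl
    row i (no i≢v) (no i≢w) = begin
      L i v * 1ℚ + L i w * - 1ℚ  ≡⟨ cong (λ a → a * 1ℚ + L i w * - 1ℚ) same-entry ⟩
      L i w * 1ℚ + L i w * - 1ℚ  ≡⟨ elsewhere (L i w) (d + 1ℚ) ⟩
      (d + 1ℚ) * 0ℚ              ≡⟨ cong ((d + 1ℚ) *_) (≡-sym (twinVector-other i≢v i≢w)) ⟩
      (d + 1ℚ) * x i             ∎
      where
        same-entry : L i v ≡ L i w
        same-entry = begin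
          L i v                                ≡⟨ laplacian-offDiagonal i≢v ⟩
          (if adj G i v then - 1ℚ else 0ℚ)     ≡⟨ cong (if_then - 1ℚ else 0ℚ) (same-neighbours i i≢v i≢w) ⟩
          (if adj G i w then - 1ℚ else 0ℚ)     ≡⟨ laplacian-offDiagonal i≢w ⟨
          L i w                                ∎
        elsewhere : ∀ a b → a * 1ℚ + a * - 1ℚ ≡ b * 0ℚ
        elsewhere = solve 2 (λ a b → a :* con 1ℚ :+ a :* (:- con 1ℚ) := b :* con 0ℚ) refl

    twinVector-eigenvector : IsEigenvectorEq G (ℕtoℚ (suc (degree G v))) x
    twinVector-eigenvector i = begin
      sumℚ (λ j → L i j * x j)     ≡⟨ sumℚ-pair v w v≢w _ outside ⟩
      L i v * x v + L i w * x w    ≡⟨ cong₂ (λ a b → L i v * a + L i w * b) x-at-v x-at-w ⟩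
      L i v * 1ℚ + L i w * - 1ℚ    ≡⟨ row i (i ≟ v) (i ≟ w) ⟩
      (d + 1ℚ) * x i               ≡⟨ cong (_* x i) (ℕtoℚ-suc (degree G v)) ⟨
      ℕtoℚ (suc (degree G v)) * x i ∎
      where
        outside : ∀ j → j ≢ v → j ≢ w → L i j * x j ≡ 0ℚ
        outside j j≢v j≢w = trans (cong (L i j *_) (twinVector-other j≢v j≢w)) (ℚ.*-zeroʳ (L i j))

  twinVectors-independent : ∀ {k v} (τ : Fin k → Fin n) → (∀ {r r′} → τ r ≡ τ r′ → r ≡ r′) →
                            (∀ r → τ r ≢ v) → LinearlyIndependent (λ r → twinVector v (τ r))
  twinVectors-independent {v = v} τ τ-injective τ≢v c combination≡0 r = begin
    c r                                                ≡⟨ c≡-[c*-1] (c r) ⟩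
    - (c r * - 1ℚ)                                     ≡⟨ cong (λ x → - (c r * x)) (≡-sym at-τr) ⟩
    - (c r * twinVector v (τ r) (τ r))                 ≡⟨ cong -_ (≡-sym (sumℚ-single r _ others)) ⟩
    - sumℚ (λ r′ → c r′ * twinVector v (τ r′) (τ r))   ≡⟨ cong -_ (combination≡0 (τ r)) ⟩
    0ℚ                                                 ∎
    where
      open ≡-Reasoning
      c≡-[c*-1] : ∀ x → x ≡ - (x * - 1ℚ)
      c≡-[c*-1] = solve 1 (λ x → x := :- (x :* (:- con 1ℚ))) refl
      at-τr : twinVector v (τ r) (τ r) ≡ - 1ℚ
      at-τr = cong₂ _-_ (unit-other (τ≢v r)) (unit-self (τ r))
      others : ∀ r′ → r′ ≢ r → c r′ * twinVector v (τ r′) (τ r) ≡ 0ℚ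
      others r′ r′≢r = trans (cong (c r′ *_) (twinVector-other (τ≢v r) (r′≢r ∘ ≡-sym ∘ τ-injective)))
                             (ℚ.*-zeroʳ (c r′))

  trueTwins-multiplicity : ∀ {k v} (τ : Fin k → Fin n) → (∀ {r r′} → τ r ≡ τ r′ → r ≡ r′) →
                           (∀ r → TrueTwins G v (τ r)) → EigenvalueMultAtLeast G (ℕtoℚ (suc (degree G v))) k
  trueTwins-multiplicity τ τ-injective twins =
    (λ r → twinVector _ (τ r)) ,
    twinVectors-independent τ τ-injective (λ r → ≢-sym (adjacent⇒≢ G (TrueTwins.adjacent (twins r)))) ,
    λ r → twinVector-eigenvector (twins r)

  punchOut-multiplicity : ∀ {N} (σ : Fin N → Fin n) → (∀ {r r′} → σ r ≡ σ r′ → r ≡ r′) → ∀ i →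
                          (∀ r → r ≢ i → TrueTwins G (σ i) (σ r)) →
                          EigenvalueMultAtLeast G (ℕtoℚ (suc (degree G (σ i)))) (N ∸ 1)
  punchOut-multiplicity {suc N} σ σ-injective i twins =
    trueTwins-multiplicity (σ ∘ punchIn i) (Fin.punchIn-injective i _ _ ∘ σ-injective)
      λ r → twins (punchIn i r) (Fin.punchInᵢ≢i i r)

  twinSet-multiplicity : ∀ (S : Subset n) {v} → v ∈ S → (∀ {t} → t ∈ S → t ≢ v → TrueTwins G v t) →
                         EigenvalueMultAtLeast G (ℕtoℚ (suc (degree G v))) (∣ S ∣ ∸ 1)
  twinSet-multiplicity S v∈S twins with Enumeration.element-surjective (enumerate S) v∈S
  ... | i , refl = punchOut-multiplicity element element-injective i
                     λ r r≢i → twins (element∈ r) (r≢i ∘ element-injective)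
    where open Enumeration (enumerate S)

theorem6 : ∀ {n} (G : Graph n) → Connected G → IsStrictlyChordal G →
    ∀ (S : Subset n) → IsMinimalVertexSeparator G S → ∀ (v : Fin n) → v ∈ S →
    EigenvalueMultAtLeast G (ℕtoℚ (suc (degree G v))) (∣ S ∣ ∸ 1)
theorem6 G _ (_ , H , f , block-graph , _ , adj-G) S (_ , _ , _ , _ , separator) v v∈S =
  Laplacian.twinSet-multiplicity G S v∈S λ t∈S t≢v →
    sameClass⇒trueTwins (≢-sym t≢v) (minimalSeparator⇒sameClass S block-graph separator v∈S t∈S)
  where open Blowup G H f adj-G
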